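{- Let $r\ge 5$, $\zeta=e^{2\pi i/2^r}$, $\mathbb{K}=\mathbb{Q}(\zeta+\zeta^{ -1})$, $n=2^{r-2}$, $\mathcal{O}_{\mathbb{K}}=\mathbb{Z}[\zeta+\zeta^{ -1}]$, $e_0=1$ and $e_i=\zeta^i+\zeta^{ -i}$ for $1\le i\le n-1$. Let $I\subseteq\mathcal{O}_{\mathbb{K}}$ be the $\mathbb{Z}$-module with $\mathbb{Z}$-basis consisting of the elements $(-1)^i e_i$ for $1\le i\le n-1$ together with $-2e_0+2e_1-2e_2+\cdots-2e_{n-2}+e_{n-1}=\sum_{k=0}^{n-2}2(-1)^{k+1}e_k+e_{n-1}$. Then $I$ is a principal ideal of $\mathcal{O}_{\mathbb{K}}$, namely $I=e_1\mathcal{O}_{\mathbb{K}}$. -}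

module Defs where

open import Data.Nat as ℕ using (ℕ; zero; suc; _∸_)
open import Data.Integer as ℤ using (ℤ; 0ℤ; 1ℤ; -1ℤ; _+_; _*_; -_)
open import Data.Vec using (Vec; []; _∷_; replicate; zipWith; map; tabulate)
open import Data.Fin using (Fin; toℕ)
open import Data.List using (List; []; _∷_)
open import Data.Product using (Σ; _×_; _,_)
open import Relation.Binary.PropositionalEquality using (_≡_)

-- The ring  ℤ[ζ] ≅ ℤ[X]/(X^m + 1),  m = 2^(r-1), ζ = class of X
-- (X^m + 1 is the 2^r-th cyclotomic polynomial).  An element is its
-- coefficient vector (c₀,…,c_{m-1}) w.r.t. the ℤ-basis 1,ζ,…,ζ^{m-1}.

Zζ : ℕ → Set
Zζ m = Vec ℤ m

zeroζ : ∀ {m} → Zζ m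
zeroζ = replicate _ 0ℤ

oneζ : ∀ {m} → Zζ m
oneζ = tabulate (λ i → isZero (toℕ i))
  where
  isZero : ℕ → ℤ
  isZero zero    = 1ℤ
  isZero (suc _) = 0ℤ

_⊕_ : ∀ {m} → Zζ m → Zζ m → Zζ m
_⊕_ = zipWith _+_

_·_ : ∀ {m} → ℤ → Zζ m → Zζ m
c · v = map (c *_) v

lastOr0 : ∀ {m} → Zζ m → ℤ
lastOr0 []           = 0ℤ
lastOr0 (x ∷ [])     = x
lastOr0 (x ∷ y ∷ ys) = lastOr0 (y ∷ ys)

shiftR : ∀ {m} → ℤ → Zζ m → Zζ m
shiftR a []       = []
shiftR a (x ∷ xs) = a ∷ shiftR x xs

-- multiplication by ζ, using ζ^m = -1
mulζ : ∀ {m} → Zζ m → Zζ m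
mulζ v = shiftR (- lastOr0 v) v

ζ^ : ∀ {m} → ℕ → Zζ m
ζ^ zero    = oneζ
ζ^ (suc k) = mulζ (ζ^ k)

-- ring multiplication:  a · (Σ_j b_j ζ^j) = Σ_j b_j (ζ^j a)
mulL : ∀ {m k} → Zζ m → Vec ℤ k → Zζ m
mulL a []       = zeroζ
mulL a (c ∷ cs) = (c · a) ⊕ mulL (mulζ a) cs

_⊗_ : ∀ {m} → Zζ m → Zζ m → Zζ m
a ⊗ b = mulL a b

-- Data attached to r:  m = 2^(r-1) (so ζ has order 2m = 2^r), n = 2^(r-2)

mOf : ℕ → ℕ
mOf r = 2 ℕ.^ (r ∸ 1)

nOf : ℕ → ℕ
nOf r = 2 ℕ.^ (r ∸ 2)

-- e₀ = 1,  e_i = ζ^i + ζ^{-i} = ζ^i + ζ^{2m-i}  (i ≥ 1)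
e : (r : ℕ) → ℕ → Zζ (mOf r)
e r zero      = oneζ
e r (suc i)   = ζ^ (suc i) ⊕ ζ^ (2 ℕ.* mOf r ∸ suc i)

sumFrom : ∀ {m} → ℕ → ℕ → (ℕ → Zζ m) → Zζ m
sumFrom a zero      f = zeroζ
sumFrom a (suc len) f = f a ⊕ sumFrom (suc a) len f

-- membership in O_K = ℤ[ζ + ζ⁻¹]: x is an integer polynomial in e₁
evalPoly : ∀ {m} → List ℤ → Zζ m → Zζ m
evalPoly []       t = zeroζ
evalPoly (c ∷ cs) t = (c · oneζ) ⊕ (t ⊗ evalPoly cs t)

InOK : (r : ℕ) → Zζ (mOf r) → Set
InOK r x = Σ (List ℤ) λ p → x ≡ evalPoly p (e r 1)

special : (r : ℕ) → Zζ (mOf r)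
special r = sumFrom 0 (nOf r ∸ 1) (λ k → (ℤ.+ 2 * (-1ℤ ℤ.^ suc k)) · e r k)
            ⊕ e r (nOf r ∸ 1)

InI : (r : ℕ) → Zζ (mOf r) → Set
InI r x = Σ ℤ λ a → Σ (ℕ → ℤ) λ c →
  x ≡ (a · special r) ⊕ sumFrom 1 (nOf r ∸ 1) (λ i → (c i * (-1ℤ ℤ.^ i)) · e r i)

InE1OK : (r : ℕ) → Zζ (mOf r) → Set
InE1OK r x = Σ (Zζ (mOf r)) λ y → InOK r y × x ≡ (e r 1 ⊗ y)

-- The
-- proof runs along the sequence Cos i = ζ^i + ζ^(-i), which satisfies
-- Cos 0 = 2, Cos i = e_i for 0 < i < n, Cos n = 0 and the recurrence
-- e₁ · Cos (i+1) = Cos (i+2) + Cos i.  Then: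
--  * I is the least submodule containing 2, e₁, …, e_{n-1}, since
--    special = -2 + (a combination of e₁, …, e_{n-1}).
--  * e₁ O_K ⊆ I: O_K lies in the span of e₀, …, e_{n-1}, and each e₁ e_i is
--    a sum of two values of Cos, which lie in every such submodule.
--  * I ⊆ e₁ O_K: the recurrence gives Cos (2j) ≡ (-1)^j · 2 modulo e₁ O_K,
--    so 2 ≡ ±Cos n = 0 as n is even; from 2 and e₁ the recurrence then
--    yields every e_i.

module Submission where

open import Defs
open import Data.Nat as ℕ using (ℕ; zero; suc; _∸_; _≤_; _<_; z≤n; s≤s)
import Data.Nat.Properties as ℕP
open import Data.Nat.GeneralisedArithmetic using (iterate)
open import Data.Integer as ℤ using (ℤ; 0ℤ; 1ℤ; -1ℤ; _+_; _*_; -_)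
import Data.Integer.Properties as ℤP
open import Data.Integer.Tactic.RingSolver using (solve-∀)
open import Data.Vec using (Vec; []; _∷_; replicate)
import Data.Vec.Properties as VecP
open import Data.List using (List; []; _∷_)
open import Data.Product using (_×_; _,_)
open import Data.Sum using (inj₁; inj₂)
open import Data.Empty using (⊥-elim)
open import Function using (_∘_)
open import Relation.Nullary using (yes; no)
open import Relation.Binary.PropositionalEquality

neg : ∀ {m} → Zζ m → Zζ m
neg v = -1ℤ · v

_⊖_ : ∀ {m} → Zζ m → Zζ m → Zζ m
x ⊖ y = x ⊕ neg y

two : ∀ {m} → Zζ m
two = oneζ ⊕ oneζ

⊕-comm : ∀ {m} (x y : Zζ m) → x ⊕ y ≡ y ⊕ x
⊕-comm = VecP.zipWith-comm ℤP.+-comm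

⊕-assoc : ∀ {m} (x y z : Zζ m) → (x ⊕ y) ⊕ z ≡ x ⊕ (y ⊕ z)
⊕-assoc = VecP.zipWith-assoc ℤP.+-assoc

⊕-identityˡ : ∀ {m} (x : Zζ m) → zeroζ ⊕ x ≡ x
⊕-identityˡ = VecP.zipWith-identityˡ ℤP.+-identityˡ

⊕-identityʳ : ∀ {m} (x : Zζ m) → x ⊕ zeroζ ≡ x
⊕-identityʳ = VecP.zipWith-identityʳ ℤP.+-identityʳ

⊖-self : ∀ {m} (x : Zζ m) → x ⊖ x ≡ zeroζ
⊖-self = VecP.zipWith-inverseʳ λ a → trans (cong (a +_) (ℤP.-1*i≡-i a)) (ℤP.+-inverseʳ a)

·-distribˡ : ∀ {m} c (x y : Zζ m) → c · (x ⊕ y) ≡ (c · x) ⊕ (c · y)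
·-distribˡ c [] [] = refl
·-distribˡ c (a ∷ x) (b ∷ y) = cong₂ _∷_ (ℤP.*-distribˡ-+ c a b) (·-distribˡ c x y)

·-distribʳ : ∀ {m} c d (x : Zζ m) → (c + d) · x ≡ (c · x) ⊕ (d · x)
·-distribʳ c d [] = refl
·-distribʳ c d (a ∷ x) = cong₂ _∷_ (ℤP.*-distribʳ-+ a c d) (·-distribʳ c d x)

·-assoc : ∀ {m} c d (x : Zζ m) → c · (d · x) ≡ (c * d) · x
·-assoc c d x = trans (sym (VecP.map-∘ (c *_) (d *_) x))
                      (VecP.map-cong (λ a → sym (ℤP.*-assoc c d a)) x)

·-identity : ∀ {m} (x : Zζ m) → 1ℤ · x ≡ x
·-identity x = trans (VecP.map-cong ℤP.*-identityˡ x) (VecP.map-id x)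

·-zeroˡ : ∀ {m} (x : Zζ m) → 0ℤ · x ≡ zeroζ
·-zeroˡ x = trans (VecP.map-cong ℤP.*-zeroˡ x) (VecP.map-const x 0ℤ)

·-zeroʳ : ∀ {m} c → c · zeroζ {m} ≡ zeroζ
·-zeroʳ {m} c = trans (VecP.map-replicate (c *_) 0ℤ m) (cong (replicate m) (ℤP.*-zeroʳ c))

neg-involutive : ∀ {m} (x : Zζ m) → neg (neg x) ≡ x
neg-involutive x = trans (·-assoc -1ℤ -1ℤ x) (·-identity x)

⊕-medial : ∀ {m} (a b c d : Zζ m) → (a ⊕ b) ⊕ (c ⊕ d) ≡ (a ⊕ c) ⊕ (b ⊕ d)
⊕-medial a b c d = begin
  (a ⊕ b) ⊕ (c ⊕ d) ≡⟨ ⊕-assoc a b (c ⊕ d) ⟩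
  a ⊕ (b ⊕ (c ⊕ d)) ≡⟨ cong (a ⊕_) (sym (⊕-assoc b c d)) ⟩
  a ⊕ ((b ⊕ c) ⊕ d) ≡⟨ cong (λ z → a ⊕ (z ⊕ d)) (⊕-comm b c) ⟩
  a ⊕ ((c ⊕ b) ⊕ d) ≡⟨ cong (a ⊕_) (⊕-assoc c b d) ⟩
  a ⊕ (c ⊕ (b ⊕ d)) ≡⟨ sym (⊕-assoc a c (b ⊕ d)) ⟩
  (a ⊕ c) ⊕ (b ⊕ d) ∎
  where open ≡-Reasoning

⊕-⊖-cancel : ∀ {m} (x y : Zζ m) → (x ⊕ y) ⊖ y ≡ x
⊕-⊖-cancel x y = trans (⊕-assoc x y (neg y)) (trans (cong (x ⊕_) (⊖-self y)) (⊕-identityʳ x))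

⊖-⊕-swap : ∀ {m} (a b c d : Zζ m) → (a ⊕ b) ⊖ (c ⊕ d) ≡ (a ⊖ d) ⊕ (b ⊖ c)
⊖-⊕-swap a b c d = begin
  (a ⊕ b) ⊕ neg (c ⊕ d)       ≡⟨ cong ((a ⊕ b) ⊕_) (·-distribˡ -1ℤ c d) ⟩
  (a ⊕ b) ⊕ (neg c ⊕ neg d)   ≡⟨ cong ((a ⊕ b) ⊕_) (⊕-comm (neg c) (neg d)) ⟩
  (a ⊕ b) ⊕ (neg d ⊕ neg c)   ≡⟨ ⊕-medial a b (neg d) (neg c) ⟩
  (a ⊖ d) ⊕ (b ⊖ c)           ∎
  where open ≡-Reasoning

-- ℤ-linear endomorphisms of Zζ m.  Multiplication by ζ, its iterates and
-- left multiplication by a fixed element are linear; this is all the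
-- ring structure of ℤ[ζ] the proof needs.
record Linear {m} (f : Zζ m → Zζ m) : Set where
  field
    map-⊕ : ∀ x y → f (x ⊕ y) ≡ f x ⊕ f y
    map-· : ∀ c x → f (c · x) ≡ c · f x

  map-zero : f zeroζ ≡ zeroζ
  map-zero = begin
    f zeroζ          ≡⟨ cong f (sym (·-zeroˡ zeroζ)) ⟩
    f (0ℤ · zeroζ)   ≡⟨ map-· 0ℤ zeroζ ⟩
    0ℤ · f zeroζ     ≡⟨ ·-zeroˡ (f zeroζ) ⟩
    zeroζ            ∎
    where open ≡-Reasoning

  map-⊖ : ∀ x y → f (x ⊖ y) ≡ f x ⊖ f y
  map-⊖ x y = trans (map-⊕ x (neg y)) (cong (f x ⊕_) (map-· -1ℤ y))

open Linear

iterate-linear : ∀ {m} {f : Zζ m → Zζ m} → Linear f → ∀ k → Linear (λ x → iterate f x k)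
iterate-linear L zero    = record { map-⊕ = λ _ _ → refl ; map-· = λ _ _ → refl }
iterate-linear {f = f} L (suc k) = record
  { map-⊕ = λ x y → trans (cong (λ z → iterate f z k) (map-⊕ L x y))
                          (map-⊕ (iterate-linear L k) (f x) (f y))
  ; map-· = λ c x → trans (cong (λ z → iterate f z k) (map-· L c x))
                          (map-· (iterate-linear L k) c (f x))
  }

lastOr0-⊕ : ∀ {m} (x y : Zζ m) → lastOr0 (x ⊕ y) ≡ lastOr0 x + lastOr0 y
lastOr0-⊕ []            []            = refl
lastOr0-⊕ (a ∷ [])      (b ∷ [])      = refl
lastOr0-⊕ (_ ∷ a ∷ x)   (_ ∷ b ∷ y)   = lastOr0-⊕ (a ∷ x) (b ∷ y)

lastOr0-· : ∀ {m} c (x : Zζ m) → lastOr0 (c · x) ≡ c * lastOr0 x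
lastOr0-· c []          = sym (ℤP.*-zeroʳ c)
lastOr0-· c (a ∷ [])    = refl
lastOr0-· c (_ ∷ a ∷ x) = lastOr0-· c (a ∷ x)

shiftR-⊕ : ∀ {m} a b (x y : Zζ m) → shiftR (a + b) (x ⊕ y) ≡ shiftR a x ⊕ shiftR b y
shiftR-⊕ a b []      []      = refl
shiftR-⊕ a b (x ∷ xs) (y ∷ ys) = cong (a + b ∷_) (shiftR-⊕ x y xs ys)

shiftR-· : ∀ {m} c a (x : Zζ m) → shiftR (c * a) (c · x) ≡ c · shiftR a x
shiftR-· c a []       = refl
shiftR-· c a (x ∷ xs) = cong (c * a ∷_) (shiftR-· c x xs)

mulζ-linear : ∀ {m} → Linear (mulζ {m})
mulζ-linear = record
  { map-⊕ = λ x y → trans (cong (λ t → shiftR t (x ⊕ y))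
                              (trans (cong -_ (lastOr0-⊕ x y)) (ℤP.neg-distrib-+ (lastOr0 x) (lastOr0 y))))
                         (shiftR-⊕ _ _ x y)
  ; map-· = λ c x → trans (cong (λ t → shiftR t (c · x))
                              (trans (cong -_ (lastOr0-· c x)) (ℤP.neg-distribʳ-* c (lastOr0 x))))
                         (shiftR-· c _ x)
  }

mulL-zero : ∀ {m} k (a : Zζ m) → mulL a (zeroζ {k}) ≡ zeroζ
mulL-zero zero    a = refl
mulL-zero (suc k) a = trans (cong₂ _⊕_ (·-zeroˡ a) (mulL-zero k (mulζ a))) (⊕-identityˡ zeroζ)

mulL-⊕ : ∀ {m k} (a : Zζ m) (u v : Vec ℤ k) → mulL a (u ⊕ v) ≡ mulL a u ⊕ mulL a v
mulL-⊕ a []      []      = sym (⊕-identityˡ zeroζ)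
mulL-⊕ a (c ∷ u) (d ∷ v) = begin
  ((c + d) · a) ⊕ mulL (mulζ a) (u ⊕ v)
    ≡⟨ cong₂ _⊕_ (·-distribʳ c d a) (mulL-⊕ (mulζ a) u v) ⟩
  ((c · a) ⊕ (d · a)) ⊕ (mulL (mulζ a) u ⊕ mulL (mulζ a) v)
    ≡⟨ ⊕-medial _ _ _ _ ⟩
  mulL a (c ∷ u) ⊕ mulL a (d ∷ v) ∎
  where open ≡-Reasoning

mulL-· : ∀ {m k} (a : Zζ m) c (u : Vec ℤ k) → mulL a (c · u) ≡ c · mulL a u
mulL-· a c []      = sym (·-zeroʳ c)
mulL-· a c (d ∷ u) = begin
  ((c * d) · a) ⊕ mulL (mulζ a) (c · u)
    ≡⟨ cong₂ _⊕_ (sym (·-assoc c d a)) (mulL-· (mulζ a) c u) ⟩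
  (c · (d · a)) ⊕ (c · mulL (mulζ a) u)
    ≡⟨ sym (·-distribˡ c _ _) ⟩
  c · mulL a (d ∷ u) ∎
  where open ≡-Reasoning

⊗-linear : ∀ {m} (a : Zζ m) → Linear (a ⊗_)
⊗-linear a = record { map-⊕ = mulL-⊕ a ; map-· = mulL-· a }

-- The k-th standard basis vector of ℤ^j (the zero vector when j ≤ k).
-- For k < m the power ζ^k is the basis vector δ m k.
δ : (j k : ℕ) → Vec ℤ j
δ zero    k       = []
δ (suc j) zero    = 1ℤ ∷ zeroζ
δ (suc j) (suc k) = 0ℤ ∷ δ j k

oneζ≡δ : ∀ {m} → oneζ {m} ≡ δ m 0
oneζ≡δ {zero}  = refl
oneζ≡δ {suc m} = cong (1ℤ ∷_)
  (trans (VecP.tabulate-cong (λ i → sym (VecP.lookup-replicate i 0ℤ))) (VecP.tabulate∘lookup zeroζ))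

δ-beyond : ∀ j k → j ≤ k → δ j k ≡ zeroζ
δ-beyond zero    k       _       = refl
δ-beyond (suc j) (suc k) (s≤s p) = cong (0ℤ ∷_) (δ-beyond j k p)

lastOr0-zero : ∀ j → lastOr0 (zeroζ {j}) ≡ 0ℤ
lastOr0-zero zero          = refl
lastOr0-zero (suc zero)    = refl
lastOr0-zero (suc (suc j)) = lastOr0-zero (suc j)

lastOr0-δ : ∀ j k → suc k < j → lastOr0 (δ j k) ≡ 0ℤ
lastOr0-δ (suc zero)    zero          (s≤s ())
lastOr0-δ (suc (suc j)) zero          _       = lastOr0-zero (suc j)
lastOr0-δ (suc (suc j)) (suc zero)    (s≤s p) = lastOr0-δ (suc j) zero p
lastOr0-δ (suc (suc j)) (suc (suc k)) (s≤s p) = lastOr0-δ (suc j) (suc k) p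

lastOr0-δ-last : ∀ k → lastOr0 (δ (suc k) k) ≡ 1ℤ
lastOr0-δ-last zero          = refl
lastOr0-δ-last (suc zero)    = refl
lastOr0-δ-last (suc (suc k)) = lastOr0-δ-last (suc k)

shiftR-zero : ∀ j → shiftR 0ℤ (zeroζ {j}) ≡ zeroζ
shiftR-zero zero    = refl
shiftR-zero (suc j) = cong (0ℤ ∷_) (shiftR-zero j)

shiftR-δ : ∀ j k → shiftR 0ℤ (δ j k) ≡ δ j (suc k)
shiftR-δ zero          k       = refl
shiftR-δ (suc zero)    zero    = refl
shiftR-δ (suc (suc j)) zero    = cong (λ v → 0ℤ ∷ 1ℤ ∷ v) (shiftR-zero j)
shiftR-δ (suc j)       (suc k) = cong (0ℤ ∷_) (shiftR-δ j k)

mulζ-δ : ∀ j k → suc k < j → mulζ (δ j k) ≡ δ j (suc k)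
mulζ-δ j k p = trans (cong (λ t → shiftR (- t) (δ j k)) (lastOr0-δ j k p)) (shiftR-δ j k)

mulζ-δ-last : ∀ k → mulζ (δ (suc k) k) ≡ neg oneζ
mulζ-δ-last k = begin
  shiftR (- lastOr0 (δ (suc k) k)) (δ (suc k) k)
                                                 ≡⟨ cong (λ t → shiftR (- t) (δ (suc k) k)) (lastOr0-δ-last k) ⟩
  shiftR -1ℤ (δ (suc k) k)                       ≡⟨ top k ⟩
  -1ℤ ∷ zeroζ                                    ≡⟨ cong (-1ℤ ∷_) (sym (·-zeroʳ -1ℤ)) ⟩
  neg (δ (suc k) 0)                              ≡⟨ cong neg (sym oneζ≡δ) ⟩
  neg oneζ                                       ∎
  where
  open ≡-Reasoning
  top : ∀ k → shiftR -1ℤ (δ (suc k) k) ≡ -1ℤ ∷ zeroζ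
  top zero    = refl
  top (suc k) = cong (-1ℤ ∷_) (trans (shiftR-δ (suc k) k) (δ-beyond (suc k) (suc k) ℕP.≤-refl))

ζ^≡δ : ∀ {m} k → k < m → ζ^ {m} k ≡ δ m k
ζ^≡δ     zero    _ = oneζ≡δ
ζ^≡δ {m} (suc k) p = trans (cong mulζ (ζ^≡δ k (ℕP.<⇒≤ p))) (mulζ-δ m k p)

ζ^-half : ∀ {m} → ζ^ {m} m ≡ neg oneζ
ζ^-half {zero}  = refl
ζ^-half {suc m} = trans (cong mulζ (ζ^≡δ m ℕP.≤-refl)) (mulζ-δ-last m)

ζ^-m+ : ∀ {m} j → ζ^ {m} (m ℕ.+ j) ≡ neg (ζ^ j)
ζ^-m+ {m} zero    = trans (cong ζ^ (ℕP.+-identityʳ m)) ζ^-half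
ζ^-m+ {m} (suc j) = begin
  ζ^ (m ℕ.+ suc j)     ≡⟨ cong ζ^ (ℕP.+-suc m j) ⟩
  mulζ (ζ^ (m ℕ.+ j))  ≡⟨ cong mulζ (ζ^-m+ j) ⟩
  mulζ (neg (ζ^ j))    ≡⟨ map-· mulζ-linear -1ℤ (ζ^ j) ⟩
  neg (ζ^ (suc j))     ∎
  where open ≡-Reasoning

ζ^-iterate : ∀ {m} k j → iterate mulζ (ζ^ {m} j) k ≡ ζ^ (k ℕ.+ j)
ζ^-iterate zero    j = refl
ζ^-iterate (suc k) j = trans (ζ^-iterate k (suc j)) (cong ζ^ (ℕP.+-suc k j))

mulL-δ : ∀ {m} j k (a : Zζ m) → k < j → mulL a (δ j k) ≡ iterate mulζ a k
mulL-δ (suc j) zero    a _       = trans (cong₂ _⊕_ (·-identity a) (mulL-zero j (mulζ a))) (⊕-identityʳ a)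
mulL-δ (suc j) (suc k) a (s≤s p) = trans (cong₂ _⊕_ (·-zeroˡ a) (mulL-δ j k (mulζ a) p)) (⊕-identityˡ _)

⊗-ζ^ : ∀ {m} (a : Zζ m) k → k < m → a ⊗ ζ^ k ≡ iterate mulζ a k
⊗-ζ^ {m} a k p = trans (cong (a ⊗_) (ζ^≡δ k p)) (mulL-δ m k a p)

∸-peel : ∀ {m k} → k < m → m ∸ k ≡ suc (m ∸ suc k)
∸-peel {suc m} {zero}  _       = refl
∸-peel {suc m} {suc k} (s≤s p) = ∸-peel p

-- Cos i = ζ^i + ζ^(-i), written with exponents in [0, m] as ζ^i - ζ^(m-i).
-- For 1 ≤ i ≤ m it is the element e_i; moreover Cos 0 = 2 (whereas e₀ = 1)
-- and Cos (m/2) = 0.  These are the values of the Chebyshev-type sequence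
-- satisfying Cos 1 · Cos (i+1) = Cos (i+2) + Cos i.
Cos : ∀ {m} → ℕ → Zζ m
Cos {m} i = ζ^ i ⊖ ζ^ (m ∸ i)

ζ^-reflect : ∀ {m} i → i ≤ m → ζ^ {m} i ⊕ ζ^ (2 ℕ.* m ∸ i) ≡ Cos i
ζ^-reflect {m} i p = cong (ζ^ i ⊕_) (begin
  ζ^ (m ℕ.+ (m ℕ.+ 0) ∸ i)   ≡⟨ cong ζ^ (ℕP.+-∸-assoc m (ℕP.≤-trans p (ℕP.m≤m+n m 0))) ⟩
  ζ^ (m ℕ.+ (m ℕ.+ 0 ∸ i))   ≡⟨ ζ^-m+ _ ⟩
  neg (ζ^ (m ℕ.+ 0 ∸ i))     ≡⟨ cong (λ t → neg (ζ^ (t ∸ i))) (ℕP.+-identityʳ m) ⟩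
  neg (ζ^ (m ∸ i))           ∎)
  where open ≡-Reasoning

Cos-zero : ∀ {m} → Cos {m} 0 ≡ two
Cos-zero = cong (oneζ ⊕_) (trans (cong neg ζ^-half) (neg-involutive oneζ))

Cos-half : ∀ {m} n → n ℕ.+ n ≡ m → Cos {m} n ≡ zeroζ
Cos-half n refl = trans (cong (λ t → ζ^ n ⊖ ζ^ t) (ℕP.m+n∸m≡n n n)) (⊖-self (ζ^ n))

Cos-one-⊗-one : ∀ {m} → 0 < m → Cos {m} 1 ⊗ oneζ ≡ Cos 1
Cos-one-⊗-one p = ⊗-ζ^ (Cos 1) 0 p

Cos-one-⊗-ζ^ : ∀ {m} j → suc j < m → Cos {m} 1 ⊗ ζ^ (suc j) ≡ ζ^ (suc (suc j)) ⊕ ζ^ j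
Cos-one-⊗-ζ^ {suc m} j p = begin
  Cos 1 ⊗ ζ^ (suc j)
    ≡⟨ ⊗-ζ^ (Cos 1) (suc j) p ⟩
  iterate mulζ (ζ^ 1 ⊖ ζ^ m) (suc j)
    ≡⟨ map-⊖ (iterate-linear mulζ-linear (suc j)) (ζ^ 1) (ζ^ m) ⟩
  iterate mulζ (ζ^ 1) (suc j) ⊖ iterate mulζ (ζ^ m) (suc j)
    ≡⟨ cong₂ _⊖_ (ζ^-iterate (suc j) 1) (ζ^-iterate (suc j) m) ⟩
  ζ^ (suc j ℕ.+ 1) ⊖ ζ^ (suc j ℕ.+ m)
    ≡⟨ cong₂ (λ a b → ζ^ a ⊖ ζ^ (suc b)) (ℕP.+-comm (suc j) 1) (ℕP.+-comm j m) ⟩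
  ζ^ (suc (suc j)) ⊖ ζ^ (suc m ℕ.+ j)
    ≡⟨ cong (λ z → ζ^ (suc (suc j)) ⊕ neg z) (ζ^-m+ j) ⟩
  ζ^ (suc (suc j)) ⊕ neg (neg (ζ^ j))
    ≡⟨ cong (ζ^ (suc (suc j)) ⊕_) (neg-involutive (ζ^ j)) ⟩
  ζ^ (suc (suc j)) ⊕ ζ^ j
    ∎
  where open ≡-Reasoning

Cos-rec : ∀ {m} j → suc (suc (suc j)) ≤ m → Cos {m} 1 ⊗ Cos (suc j) ≡ Cos (suc (suc j)) ⊕ Cos j
Cos-rec {m} j p = begin
  Cos 1 ⊗ (ζ^ (suc j) ⊖ ζ^ (m ∸ suc j))
    ≡⟨ map-⊖ (⊗-linear (Cos 1)) (ζ^ (suc j)) _ ⟩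
  (Cos 1 ⊗ ζ^ (suc j)) ⊖ (Cos 1 ⊗ ζ^ (m ∸ suc j))
    ≡⟨ cong (λ t → (Cos 1 ⊗ ζ^ (suc j)) ⊖ (Cos 1 ⊗ ζ^ t)) m-[j+1] ⟩
  (Cos 1 ⊗ ζ^ (suc j)) ⊖ (Cos 1 ⊗ ζ^ (suc b))
    ≡⟨ cong₂ _⊖_ (Cos-one-⊗-ζ^ j j+1<m) (Cos-one-⊗-ζ^ b b+1<m) ⟩
  (ζ^ (suc (suc j)) ⊕ ζ^ j) ⊖ (ζ^ (suc (suc b)) ⊕ ζ^ b)
    ≡⟨ ⊖-⊕-swap _ _ _ _ ⟩
  (ζ^ (suc (suc j)) ⊖ ζ^ b) ⊕ (ζ^ j ⊖ ζ^ (suc (suc b)))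
    ≡⟨ cong (λ t → Cos (suc (suc j)) ⊕ (ζ^ j ⊖ ζ^ t)) (sym m-j) ⟩
  Cos (suc (suc j)) ⊕ Cos j
    ∎
  where
  open ≡-Reasoning
  b = m ∸ suc (suc j)
  j+1<m : suc j < m
  j+1<m = ℕP.<⇒≤ p
  m-[j+1] : m ∸ suc j ≡ suc b
  m-[j+1] = ∸-peel j+1<m
  m-j : m ∸ j ≡ suc (suc b)
  m-j = trans (∸-peel (ℕP.<⇒≤ j+1<m)) (cong suc m-[j+1])
  b+1<m : suc b < m
  b+1<m = subst (_< m) m-[j+1] (ℕP.∸-monoʳ-< (s≤s z≤n) (ℕP.<⇒≤ j+1<m))

sum-cong : ∀ {m} a len {f g : ℕ → Zζ m} → (∀ i → f i ≡ g i) → sumFrom a len f ≡ sumFrom a len g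
sum-cong a zero      f≗g = refl
sum-cong a (suc len) f≗g = cong₂ _⊕_ (f≗g a) (sum-cong (suc a) len f≗g)

sum-⊕ : ∀ {m} a len (f g : ℕ → Zζ m) → sumFrom a len f ⊕ sumFrom a len g ≡ sumFrom a len (λ i → f i ⊕ g i)
sum-⊕ a zero      f g = ⊕-identityˡ zeroζ
sum-⊕ a (suc len) f g = trans (⊕-medial _ _ _ _) (cong ((f a ⊕ g a) ⊕_) (sum-⊕ (suc a) len f g))

sum-· : ∀ {m} c a len (f : ℕ → Zζ m) → c · sumFrom a len f ≡ sumFrom a len (λ i → c · f i)
sum-· c a zero      f = ·-zeroʳ c
sum-· c a (suc len) f = trans (·-distribˡ c _ _) (cong ((c · f a) ⊕_) (sum-· c (suc a) len f))

sum-zero : ∀ {m} a len (f : ℕ → Zζ m) → (∀ i → a ≤ i → f i ≡ zeroζ) → sumFrom a len f ≡ zeroζ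
sum-zero a zero      f f≡0 = refl
sum-zero a (suc len) f f≡0 =
  trans (cong₂ _⊕_ (f≡0 a ℕP.≤-refl) (sum-zero (suc a) len f (λ i p → f≡0 i (ℕP.<⇒≤ p)))) (⊕-identityˡ zeroζ)

sum-single : ∀ {m} a len (f : ℕ → Zζ m) j → a ≤ j → j < a ℕ.+ len →
             (∀ i → i ≢ j → f i ≡ zeroζ) → sumFrom a len f ≡ f j
sum-single a zero f j a≤j j<a _ =
  ⊥-elim (ℕP.<-irrefl refl (ℕP.≤-<-trans a≤j (subst (j <_) (ℕP.+-identityʳ a) j<a)))
sum-single a (suc len) f j a≤j j<a+len f≡0 with ℕP.m≤n⇒m<n∨m≡n a≤j
... | inj₂ refl = trans (cong (f a ⊕_) (sum-zero (suc a) len f (λ i a<i → f≡0 i (ℕP.>⇒≢ a<i)))) (⊕-identityʳ (f a))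
... | inj₁ a<j  = trans (cong₂ _⊕_ (f≡0 a (ℕP.<⇒≢ a<j)) rest≡f-j) (⊕-identityˡ (f j))
  where
  rest≡f-j : sumFrom (suc a) len f ≡ f j
  rest≡f-j = sum-single (suc a) len f j a<j (subst (j <_) (ℕP.+-suc a len) j<a+len) f≡0

record Submodule {m} (P : Zζ m → Set) : Set where
  field
    has-zero : P zeroζ
    has-⊕    : ∀ {x y} → P x → P y → P (x ⊕ y)
    has-·    : ∀ c {x} → P x → P (c · x)

  has-⊖ : ∀ {x y} → P x → P y → P (x ⊖ y)
  has-⊖ px py = has-⊕ px (has-· -1ℤ py)

  has-sum : ∀ a len (f : ℕ → Zζ m) → (∀ i → a ≤ i → i < a ℕ.+ len → P (f i)) → P (sumFrom a len f)
  has-sum a zero      f Pf = has-zero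
  has-sum a (suc len) f Pf =
    has-⊕ (Pf a ℕP.≤-refl (ℕP.m<m+n a (s≤s z≤n)))
          (has-sum (suc a) len f (λ i a<i i<end → Pf i (ℕP.<⇒≤ a<i) (subst (i <_) (sym (ℕP.+-suc a len)) i<end)))

open Submodule

preimage : ∀ {m} {P : Zζ m → Set} {f : Zζ m → Zζ m} → Linear f → Submodule P → Submodule (P ∘ f)
preimage {P = P} L S = record
  { has-zero = subst P (sym (map-zero L)) (has-zero S)
  ; has-⊕    = λ {x} {y} px py → subst P (sym (map-⊕ L x y)) (has-⊕ S px py)
  ; has-·    = λ c {x} px → subst P (sym (map-· L c x)) (has-· S c px)
  }

data Span {m} (n : ℕ) (g : ℕ → Zζ m) : Zζ m → Set where
  span-zero : Span n g zeroζ
  span-⊕    : ∀ {x y} → Span n g x → Span n g y → Span n g (x ⊕ y)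
  span-·    : ∀ c {x} → Span n g x → Span n g (c · x)
  span-gen  : ∀ i → i < n → Span n g (g i)

span-submodule : ∀ {m} {n} {g : ℕ → Zζ m} → Submodule (Span n g)
span-submodule = record { has-zero = span-zero ; has-⊕ = span-⊕ ; has-· = span-· }

span-least : ∀ {m} {n} {g : ℕ → Zζ m} {P : Zζ m → Set} → Submodule P →
             (∀ i → i < n → P (g i)) → ∀ {x} → Span n g x → P x
span-least S Pg span-zero      = has-zero S
span-least S Pg (span-⊕ s t)   = has-⊕ S (span-least S Pg s) (span-least S Pg t)
span-least S Pg (span-· c s)   = has-· S c (span-least S Pg s)
span-least S Pg (span-gen i p) = Pg i p

addP : List ℤ → List ℤ → List ℤ
addP []      q       = q
addP (c ∷ p) []      = c ∷ p
addP (c ∷ p) (d ∷ q) = (c + d) ∷ addP p q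

scaleP : ℤ → List ℤ → List ℤ
scaleP c []      = []
scaleP c (d ∷ p) = (c * d) ∷ scaleP c p

evalPoly-add : ∀ {m} p q (t : Zζ m) → evalPoly (addP p q) t ≡ evalPoly p t ⊕ evalPoly q t
evalPoly-add []      q       t = sym (⊕-identityˡ _)
evalPoly-add (c ∷ p) []      t = sym (⊕-identityʳ _)
evalPoly-add (c ∷ p) (d ∷ q) t = begin
  ((c + d) · oneζ) ⊕ (t ⊗ evalPoly (addP p q) t)
    ≡⟨ cong₂ _⊕_ (·-distribʳ c d oneζ)
                 (trans (cong (t ⊗_) (evalPoly-add p q t)) (mulL-⊕ t (evalPoly p t) (evalPoly q t))) ⟩
  ((c · oneζ) ⊕ (d · oneζ)) ⊕ ((t ⊗ evalPoly p t) ⊕ (t ⊗ evalPoly q t))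
    ≡⟨ ⊕-medial _ _ _ _ ⟩
  evalPoly (c ∷ p) t ⊕ evalPoly (d ∷ q) t ∎
  where open ≡-Reasoning

evalPoly-scale : ∀ {m} c p (t : Zζ m) → evalPoly (scaleP c p) t ≡ c · evalPoly p t
evalPoly-scale c []      t = sym (·-zeroʳ c)
evalPoly-scale c (d ∷ p) t = begin
  ((c * d) · oneζ) ⊕ (t ⊗ evalPoly (scaleP c p) t)
    ≡⟨ cong₂ _⊕_ (sym (·-assoc c d oneζ))
                 (trans (cong (t ⊗_) (evalPoly-scale c p t)) (mulL-· t c (evalPoly p t))) ⟩
  (c · (d · oneζ)) ⊕ (c · (t ⊗ evalPoly p t))
    ≡⟨ sym (·-distribˡ c _ _) ⟩
  c · evalPoly (d ∷ p) t ∎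
  where open ≡-Reasoning

sgn : ℕ → ℤ
sgn i = -1ℤ ℤ.^ i

sgn-sq : ∀ i → sgn i * sgn i ≡ 1ℤ
sgn-sq zero    = refl
sgn-sq (suc i) = trans (square-neg (sgn i)) (sgn-sq i)
  where
  square-neg : ∀ (s : ℤ) → (-1ℤ * s) * (-1ℤ * s) ≡ s * s
  square-neg = solve-∀

-- -2 · 1 = -(1 + 1); the coefficient of e₀ in the special generator.
minus-two : ∀ {m} → (ℤ.+ 2 * sgn 1) · oneζ {m} ≡ neg two
minus-two = trans (·-distribʳ -1ℤ -1ℤ oneζ) (sym (·-distribˡ -1ℤ oneζ oneζ))

-- y + (-c)w = (y + v) - (v + c w): the step of an alternating telescope.
telescope-step : ∀ {m} c (y v w : Zζ m) → y ⊕ ((-1ℤ * c) · w) ≡ (y ⊕ v) ⊖ (v ⊕ (c · w))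
telescope-step c []      []      []      = refl
telescope-step c (y ∷ ys) (v ∷ vs) (w ∷ ws) = cong₂ _∷_ (coord c y v w) (telescope-step c ys vs ws)
  where
  coord : ∀ (c y v w : ℤ) → y + (-1ℤ * c) * w ≡ (y + v) + -1ℤ * (v + c * w)
  coord = solve-∀

-- The theorem for r = r₃ + 3, where n = 2K with K = 2^r₃ and m = 2n.
module Ideal (r₃ : ℕ) where

  r K n m : ℕ
  r = suc (suc (suc r₃))
  K = 2 ℕ.^ r₃
  n = nOf r
  m = mOf r

  E : ℕ → Zζ m
  E = e r

  E1 : Zζ m
  E1 = E 1

  n+n≡m : n ℕ.+ n ≡ m
  n+n≡m = cong (n ℕ.+_) (sym (ℕP.+-identityʳ n))

  1≤K : 1 ≤ K
  1≤K = ℕP.m^n>0 2 r₃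

  2≤n : 2 ≤ n
  2≤n = ℕP.+-mono-≤ 1≤K (ℕP.+-mono-≤ 1≤K z≤n)

  n<m : n < m
  n<m = ℕP.m<m+n n (ℕP.<-≤-trans (s≤s z≤n) (ℕP.≤-trans 2≤n (ℕP.m≤m+n n 0)))

  0<n : 0 < n
  0<n = ℕP.≤-trans (s≤s z≤n) 2≤n

  0<m : 0 < m
  0<m = ℕP.≤-trans 0<n (ℕP.<⇒≤ n<m)

  <n⇒≤m : ∀ {i} → i < n → i ≤ m
  <n⇒≤m i<n = ℕP.≤-trans (ℕP.<⇒≤ i<n) (ℕP.<⇒≤ n<m)

  n≡1+[n∸1] : n ≡ suc (n ∸ 1)
  n≡1+[n∸1] = ∸-peel 0<n

  n∸1≡1+[n∸2] : n ∸ 1 ≡ suc (n ∸ 2)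
  n∸1≡1+[n∸2] = ∸-peel 2≤n

  n∸1<n : n ∸ 1 < n
  n∸1<n = subst (n ∸ 1 <_) (sym n≡1+[n∸1]) ℕP.≤-refl

  1≤n∸1 : 1 ≤ n ∸ 1
  1≤n∸1 = subst (1 ≤_) (sym n∸1≡1+[n∸2]) (s≤s z≤n)

  <1+[n∸1]⇒<n : ∀ {i} → i < suc (n ∸ 1) → i < n
  <1+[n∸1]⇒<n {i} = subst (i <_) (sym n≡1+[n∸1])

  <n∸1⇒<n : ∀ {i} → i < n ∸ 1 → i < n
  <n∸1⇒<n i<n∸1 = ℕP.<-trans i<n∸1 n∸1<n

  E≡Cos : ∀ i → 1 ≤ i → i ≤ m → E i ≡ Cos i
  E≡Cos (suc i) _ i≤m = ζ^-reflect (suc i) i≤m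

  E1≡Cos1 : E1 ≡ Cos 1
  E1≡Cos1 = E≡Cos 1 (s≤s z≤n) 0<m

  E1-rec : ∀ j → suc (suc j) ≤ n → E1 ⊗ Cos (suc j) ≡ Cos (suc (suc j)) ⊕ Cos j
  E1-rec j p = trans (cong (_⊗ Cos (suc j)) E1≡Cos1) (Cos-rec j (ℕP.≤-trans (s≤s p) n<m))

  E1-⊗-one : E1 ⊗ oneζ ≡ E1
  E1-⊗-one = trans (cong (_⊗ oneζ) E1≡Cos1) (trans (Cos-one-⊗-one 0<m) (sym E1≡Cos1))

  -- P contains 2 and e₁, …, e_{n-1}; these elements generate I.
  GenI : (Zζ m → Set) → Set
  GenI P = P two × (∀ i → 1 ≤ i → i < n → P (E i))

  cos-from-gens : ∀ {P} → Submodule P → GenI P → ∀ j → j ≤ n → P (Cos j)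
  cos-from-gens {P} S (P2 , Pe) zero _ = subst P (sym Cos-zero) P2
  cos-from-gens {P} S (P2 , Pe) (suc i) i<n with ℕP.m≤n⇒m<n∨m≡n i<n
  ... | inj₁ i+1<n = subst P (E≡Cos (suc i) (s≤s z≤n) (<n⇒≤m i+1<n)) (Pe (suc i) (s≤s z≤n) i+1<n)
  ... | inj₂ i+1≡n = subst P (sym (trans (cong Cos i+1≡n) (Cos-half n n+n≡m))) (has-zero S)

  -- Such a submodule also contains e₁ · e_i for every i < n, because
  -- e₁ e₀ = Cos 1 and e₁ e_{j+1} = Cos (j+2) + Cos j.
  E1-⊗-span : ∀ {P} → Submodule P → GenI P → ∀ {x} → Span n E x → P (E1 ⊗ x)
  E1-⊗-span {P} S gens = span-least (preimage (⊗-linear E1) S) E1-⊗-E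
    where
    PCos : ∀ j → j ≤ n → P (Cos j)
    PCos = cos-from-gens S gens
    E1-⊗-E : ∀ i → i < n → P (E1 ⊗ E i)
    E1-⊗-E zero    0<n   = subst P (sym (trans E1-⊗-one E1≡Cos1)) (PCos 1 0<n)
    E1-⊗-E (suc j) j+1<n =
      subst P (sym (trans (cong (E1 ⊗_) (E≡Cos (suc j) (s≤s z≤n) (<n⇒≤m j+1<n))) (E1-rec j j+1<n)))
        (has-⊕ S (PCos (suc (suc j)) j+1<n) (PCos j (ℕP.≤-trans (ℕP.n≤1+n j) (ℕP.<⇒≤ j+1<n))))

  -- Induction along the recurrence Cos (j+2) = e₁ Cos (j+1) - Cos j.
  cos-closed : ∀ {P} → Submodule P → P (Cos 0) → P (Cos 1) →
               (∀ j → suc (suc j) ≤ n → P (Cos (suc j)) → P (E1 ⊗ Cos (suc j))) →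
               ∀ j → j ≤ n → P (Cos j)
  cos-closed S P0 P1 step zero          _ = P0
  cos-closed S P0 P1 step (suc zero)    _ = P1
  cos-closed {P} S P0 P1 step (suc (suc j)) p =
    subst P (trans (cong (_⊖ Cos j) (E1-rec j p)) (⊕-⊖-cancel _ _))
      (has-⊖ S (step j p (cos-closed S P0 P1 step (suc j) (ℕP.<⇒≤ p)))
               (cos-closed S P0 P1 step j (ℕP.≤-trans (ℕP.n≤1+n j) (ℕP.<⇒≤ p))))

  OK-submodule : Submodule (InOK r)
  OK-submodule = record
    { has-zero = [] , refl
    ; has-⊕    = λ { (p , x≡) (q , y≡) → addP p q , trans (cong₂ _⊕_ x≡ y≡) (sym (evalPoly-add p q E1)) }
    ; has-·    = λ { c (p , x≡) → scaleP c p , trans (cong (c ·_) x≡) (sym (evalPoly-scale c p E1)) }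
    }

  OK-one : InOK r oneζ
  OK-one = (1ℤ ∷ []) , sym (trans (cong₂ _⊕_ (·-identity oneζ) (mulL-zero m E1)) (⊕-identityʳ oneζ))

  OK-⊗ : ∀ {y} → InOK r y → InOK r (E1 ⊗ y)
  OK-⊗ (p , y≡) = (0ℤ ∷ p) , trans (cong (E1 ⊗_) y≡) (sym drop-constant)
    where
    drop-constant : evalPoly (0ℤ ∷ p) E1 ≡ E1 ⊗ evalPoly p E1
    drop-constant = trans (cong (_⊕ (E1 ⊗ evalPoly p E1)) (·-zeroˡ oneζ)) (⊕-identityˡ _)

  OK-Cos : ∀ j → j ≤ n → InOK r (Cos j)
  OK-Cos = cos-closed OK-submodule
    (subst (InOK r) (sym Cos-zero) (has-⊕ OK-submodule OK-one OK-one))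
    (subst (InOK r) (trans E1-⊗-one E1≡Cos1) (OK-⊗ OK-one))
    (λ _ _ → OK-⊗)

  -- O_K lies in the span of e₀, …, e_{n-1} (which are in fact a basis):
  -- by Horner's rule, using that this span is closed under e₁ · _.
  span-gens : GenI (Span n E)
  span-gens = span-⊕ (span-gen 0 0<n) (span-gen 0 0<n) , λ i _ i<n → span-gen i i<n

  OK⊆span : ∀ {y} → InOK r y → Span n E y
  OK⊆span (p , refl) = horner p
    where
    horner : ∀ p → Span n E (evalPoly p E1)
    horner []      = span-zero
    horner (c ∷ p) = span-⊕ (span-· c (span-gen 0 0<n))
                            (E1-⊗-span span-submodule span-gens (horner p))

  E1OK : Zζ m → Set
  E1OK = InE1OK r

  E1OK-submodule : Submodule E1OK
  E1OK-submodule = record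
    { has-zero = zeroζ , has-zero OK-submodule , sym (mulL-zero m E1)
    ; has-⊕    = λ { (y , Oy , x≡) (y' , Oy' , x'≡) →
                     (y ⊕ y') , has-⊕ OK-submodule Oy Oy' , trans (cong₂ _⊕_ x≡ x'≡) (sym (mulL-⊕ E1 y y')) }
    ; has-·    = λ { c (y , Oy , x≡) → (c · y) , has-· OK-submodule c Oy , trans (cong (c ·_) x≡) (sym (mulL-· E1 c y)) }
    }

  E1OK-⊗ : ∀ {y} → InOK r y → E1OK (E1 ⊗ y)
  E1OK-⊗ Oy = _ , Oy , refl

  -- Modulo e₁ O_K we have Cos (j+2) ≡ -Cos j, their sum being e₁ Cos (j+1);
  -- hence Cos (2j) ≡ (-1)^j · 2.
  E1OK-alternating : ∀ j → 2 ℕ.* j ≤ n → E1OK (Cos (2 ℕ.* j) ⊕ (sgn (suc j) · Cos 0))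
  E1OK-alternating zero    _ = subst E1OK (sym (⊖-self (Cos 0))) (has-zero E1OK-submodule)
  E1OK-alternating (suc j) p = subst E1OK (sym chain)
      (has-⊖ E1OK-submodule (subst E1OK (E1-rec i i+2≤n) (E1OK-⊗ (OK-Cos (suc i) (ℕP.<⇒≤ i+2≤n))))
                         (E1OK-alternating j (ℕP.≤-trans (ℕP.m≤n+m i 2) i+2≤n)))
    where
    i = 2 ℕ.* j
    i+2≤n : suc (suc i) ≤ n
    i+2≤n = subst (_≤ n) (ℕP.*-suc 2 j) p
    chain : Cos (2 ℕ.* suc j) ⊕ (sgn (suc (suc j)) · Cos 0)
          ≡ (Cos (suc (suc i)) ⊕ Cos i) ⊖ (Cos i ⊕ (sgn (suc j) · Cos 0))
    chain = trans (cong (λ k → Cos k ⊕ (sgn (suc (suc j)) · Cos 0)) (ℕP.*-suc 2 j))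
                  (telescope-step (sgn (suc j)) (Cos (suc (suc i))) (Cos i) (Cos 0))

  -- Since n = 2K and Cos n = 0, this gives ±2 ∈ e₁ O_K, so 2 ∈ e₁ O_K.
  E1OK-two : E1OK two
  E1OK-two = subst E1OK (trans unsign Cos-zero) (has-· E1OK-submodule s ±2∈E1OK)
    where
    s = sgn (suc K)
    ±2∈E1OK : E1OK (s · Cos 0)
    ±2∈E1OK = subst E1OK (trans (cong (_⊕ (s · Cos 0)) (Cos-half n n+n≡m)) (⊕-identityˡ _))
                      (E1OK-alternating K ℕP.≤-refl)
    unsign : s · (s · Cos 0) ≡ Cos 0
    unsign = trans (·-assoc s s (Cos 0)) (trans (cong (_· Cos 0) (sgn-sq (suc K))) (·-identity (Cos 0)))

  E1OK-Cos : ∀ j → j ≤ n → E1OK (Cos j)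
  E1OK-Cos = cos-closed E1OK-submodule (subst E1OK (sym Cos-zero) E1OK-two)
    (subst E1OK (trans E1-⊗-one E1≡Cos1) (E1OK-⊗ OK-one))
    (λ j p _ → E1OK-⊗ (OK-Cos (suc j) (ℕP.<⇒≤ p)))

  E1OK-gens : GenI E1OK
  E1OK-gens = E1OK-two , λ i 1≤i i<n → subst E1OK (sym (E≡Cos i 1≤i (<n⇒≤m i<n)))
                                        (E1OK-Cos i (ℕP.<⇒≤ i<n))

  comb : (ℕ → ℤ) → Zζ m
  comb c = sumFrom 1 (n ∸ 1) (λ i → (c i * sgn i) · E i)

  comb-zero : comb (λ _ → 0ℤ) ≡ zeroζ
  comb-zero = sum-zero 1 (n ∸ 1) _ (λ i _ → ·-zeroˡ (E i))

  comb-⊕ : ∀ c c' → comb c ⊕ comb c' ≡ comb (λ i → c i + c' i)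
  comb-⊕ c c' = trans (sum-⊕ 1 (n ∸ 1) _ _) (sum-cong 1 (n ∸ 1) λ i →
    trans (sym (·-distribʳ (c i * sgn i) (c' i * sgn i) (E i)))
          (cong (_· E i) (sym (ℤP.*-distribʳ-+ (sgn i) (c i) (c' i)))))

  comb-· : ∀ d c → d · comb c ≡ comb (λ i → d * c i)
  comb-· d c = trans (sum-· d 1 (n ∸ 1) _) (sum-cong 1 (n ∸ 1) λ i →
    trans (·-assoc d (c i * sgn i) (E i)) (cong (_· E i) (sym (ℤP.*-assoc d (c i) (sgn i)))))

  I-submodule : Submodule (InI r)
  I-submodule = record
    { has-zero = 0ℤ , (λ _ → 0ℤ) , sym (trans (cong₂ _⊕_ (·-zeroˡ (special r)) comb-zero) (⊕-identityˡ zeroζ))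
    ; has-⊕    = λ { {x} {y} (a , c , x≡) (a' , c' , y≡) → (a + a') , (λ i → c i + c' i) ,
                     (begin
                       x ⊕ y
                         ≡⟨ cong₂ _⊕_ x≡ y≡ ⟩
                       ((a · special r) ⊕ comb c) ⊕ ((a' · special r) ⊕ comb c')
                         ≡⟨ ⊕-medial _ _ _ _ ⟩
                       ((a · special r) ⊕ (a' · special r)) ⊕ (comb c ⊕ comb c')
                         ≡⟨ cong₂ _⊕_ (sym (·-distribʳ a a' (special r))) (comb-⊕ c c') ⟩
                       ((a + a') · special r) ⊕ comb (λ i → c i + c' i)
                         ∎) }
    ; has-·    = λ { d {x} (a , c , x≡) → (d * a) , (λ i → d * c i) ,
                     (begin
                       d · x
                         ≡⟨ cong (d ·_) x≡ ⟩
                       d · ((a · special r) ⊕ comb c)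
                         ≡⟨ ·-distribˡ d _ _ ⟩
                       (d · (a · special r)) ⊕ (d · comb c)
                         ≡⟨ cong₂ _⊕_ (·-assoc d a (special r)) (comb-· d c) ⟩
                       ((d * a) · special r) ⊕ comb (λ i → d * c i)
                         ∎) }
    }
    where open ≡-Reasoning

  pick : ℕ → ℕ → ℤ
  pick j i with i ℕ.≟ j
  ... | yes _ = sgn j
  ... | no  _ = 0ℤ

  pick-term : ∀ j i → i ≢ j → (pick j i * sgn i) · E i ≡ zeroζ
  pick-term j i i≢j with i ℕ.≟ j
  ... | yes i≡j = ⊥-elim (i≢j i≡j)
  ... | no  _   = ·-zeroˡ (E i)

  pick-diag : ∀ j → (pick j j * sgn j) · E j ≡ E j
  pick-diag j with j ℕ.≟ j
  ... | yes _   = trans (cong (_· E j) (sgn-sq j)) (·-identity (E j))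
  ... | no  j≢j = ⊥-elim (j≢j refl)

  I-E : ∀ j → 1 ≤ j → j < n → InI r (E j)
  I-E j 1≤j j<n = 0ℤ , pick j , sym (begin
    (0ℤ · special r) ⊕ comb (pick j)
      ≡⟨ cong₂ _⊕_ (·-zeroˡ (special r)) (sum-single 1 (n ∸ 1) _ j 1≤j (subst (j <_) n≡1+[n∸1] j<n) (pick-term j)) ⟩
    zeroζ ⊕ ((pick j j * sgn j) · E j)
      ≡⟨ trans (⊕-identityˡ _) (pick-diag j) ⟩
    E j
      ∎)
    where open ≡-Reasoning

  -- special = -2 · e₀ + rest, with rest a combination of e₁, …, e_{n-1};
  -- hence 2 ∈ I.
  term : ℕ → Zζ m
  term k = (ℤ.+ 2 * sgn (suc k)) · E k

  rest : Zζ m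
  rest = sumFrom 1 (n ∸ 2) term ⊕ E (n ∸ 1)

  special-split : special r ≡ term 0 ⊕ rest
  special-split = trans (cong (λ L → sumFrom 0 L term ⊕ E (n ∸ 1)) n∸1≡1+[n∸2]) (⊕-assoc _ _ _)

  I-special : InI r (special r)
  I-special = 1ℤ , (λ _ → 0ℤ) , sym (trans (cong₂ _⊕_ (·-identity (special r)) comb-zero) (⊕-identityʳ _))

  I-rest : InI r rest
  I-rest = has-⊕ I-submodule
    (has-sum I-submodule 1 (n ∸ 2) term λ i 1≤i i<end →
       has-· I-submodule (ℤ.+ 2 * sgn (suc i)) (I-E i 1≤i (<n∸1⇒<n (subst (i <_) (sym n∸1≡1+[n∸2]) i<end))))
    (I-E (n ∸ 1) 1≤n∸1 n∸1<n)

  I-two : InI r two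
  I-two = subst (InI r) -[-2]≡2
    (has-· I-submodule -1ℤ (subst (InI r) special-rest≡-2 (has-⊖ I-submodule I-special I-rest)))
    where
    special-rest≡-2 : special r ⊖ rest ≡ term 0
    special-rest≡-2 = trans (cong (_⊖ rest) special-split) (⊕-⊖-cancel (term 0) rest)
    -[-2]≡2 : neg (term 0) ≡ two
    -[-2]≡2 = trans (cong neg minus-two) (neg-involutive two)

  I-gens : GenI (InI r)
  I-gens = I-two , I-E

  I-least : ∀ {P} → Submodule P → GenI P → ∀ {x} → InI r x → P x
  I-least {P} S (P2 , Pe) (a , c , x≡) =
    subst P (sym x≡) (has-⊕ S (has-· S a P-special)
      (has-sum S 1 (n ∸ 1) _ λ i 1≤i i<end → has-· S (c i * sgn i) (Pe i 1≤i (<1+[n∸1]⇒<n i<end))))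
    where
    P-term : ∀ k → 0 ≤ k → k < 0 ℕ.+ (n ∸ 1) → P (term k)
    P-term zero    _ _   = subst P (sym minus-two) (has-· S -1ℤ P2)
    P-term (suc k) _ k<n = has-· S (ℤ.+ 2 * sgn (suc (suc k))) (Pe (suc k) (s≤s z≤n) (<n∸1⇒<n k<n))
    P-special : P (special r)
    P-special = has-⊕ S (has-sum S 0 (n ∸ 1) term P-term) (Pe (n ∸ 1) 1≤n∸1 n∸1<n)

  theorem : ((x : Zζ m) → InI r x → InE1OK r x) × ((x : Zζ m) → InE1OK r x → InI r x)
  theorem = (λ x → I-least E1OK-submodule E1OK-gens)
          , (λ { x (y , Oy , x≡) → subst (InI r) (sym x≡) (E1-⊗-span I-submodule I-gens (OK⊆span Oy)) })

proposition8 : (r : ℕ) → 5 ≤ r →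
    ((x : Zζ (mOf r)) → InI r x → InE1OK r x) × ((x : Zζ (mOf r)) → InE1OK r x → InI r x)
proposition8 (suc (suc (suc r₃))) _               = Ideal.theorem r₃
proposition8 (suc (suc zero))      (s≤s (s≤s ()))
proposition8 (suc zero)            (s≤s ())
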